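{- Let $a,b,p,q$ be complex numbers with $p\neq 0$, $q\neq 0$, and let $(W_j)$, $(U_j)$ be as defined in the context. If $r$, $s$ and $t$ are any integers and $m$ and $n$ are non-negative integers, then \[ \sum_{k = 0}^n \binom{m - n + k}{k}U_{r + s}^k U_s^{n - k} W_{t + r(n - k)} = \sum_{k = 0}^n ( - q^s)^{n - k} \binom{m + 1}{k} U_{r + s}^k U_r^{n - k} W_{t - s(n - k)}. \]
   Context: The Horadam sequence $W_j=W_j(a,b;p,q)$ is defined by $W_0=a$, $W_1=b$, $W_j=pW_{j-1}-qW_{j-2}$ for $j\ge 2$, and extended to negative indices by $W_{ -j}=\frac{1}{q}(pW_{ -j+1}-W_{ -j+2})$. The Lucas sequence of the first kind is $U_j=W_j(0,1;p,q)$ (so $U_0=0$, $U_1=1$). For a complex number $x$ and a non-negative integer $k$, $\binom{x}{k}=x(x-1)\cdots(x-k+1)/k!$ (so the upper index may be negative). -}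

module Defs where

open import Level using (Level)
open import Algebra.Bundles using (CommutativeRing)
open import Data.Nat as ℕ using (ℕ; zero; suc; _∸_; _!)
open import Data.Nat.Properties using (_!≢0)
open import Data.Integer as ℤ using (ℤ; +_; -[1+_]; _/ℕ_)

falling : ℤ → ℕ → ℤ
falling x zero    = ℤ.+ 1
falling x (suc k) = falling x k ℤ.* (x ℤ.- (+ k))

-- Generalised binomial coefficient  binom x k = x(x-1)...(x-k+1)/k!
-- (the division is exact; upper index may be negative).
binom : ℤ → ℕ → ℤ
binom x k = _/ℕ_ (falling x k) (k !) {{k !≢0}}

module _ {c ℓ : Level} (R : CommutativeRing c ℓ) where
  open CommutativeRing R

  pow : Carrier → ℕ → Carrier
  pow x zero    = 1#
  pow x (suc n) = x * pow x n

  fromℕ : ℕ → Carrier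
  fromℕ zero    = 0#
  fromℕ (suc n) = 1# + fromℕ n

  fromℤ : ℤ → Carrier
  fromℤ (+ n)      = fromℕ n
  fromℤ -[1+ n ]   = - fromℕ (suc n)

  sumTo : ℕ → (ℕ → Carrier) → Carrier
  sumTo zero    f = f 0
  sumTo (suc n) f = sumTo n f + f (suc n)

  -- Horadam sequence W_j(a,b;p,q); qi is the inverse of q.
  module _ (a b p q qi : Carrier) where
    Wpos : ℕ → Carrier
    Wpos zero          = a
    Wpos (suc zero)    = b
    Wpos (suc (suc j)) = p * Wpos (suc j) - q * Wpos j

    -- backward: Wneg j = W_{-j}, using W_{-j} = q⁻¹ (p W_{-j+1} - W_{-j+2})
    Wneg : ℕ → Carrier
    Wneg zero          = a
    Wneg (suc zero)    = qi * (p * a - b)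
    Wneg (suc (suc j)) = qi * (p * Wneg (suc j) - Wneg j)

    W : ℤ → Carrier
    W (+ n)    = Wpos n
    W -[1+ n ] = Wneg (suc n)

  U : (p q qi : Carrier) → ℤ → Carrier
  U p q qi = W 0# 1# p q qi

  zpow : (x xi : Carrier) → ℤ → Carrier
  zpow x xi (+ n)    = pow x n
  zpow x xi -[1+ n ] = pow xi (suc n)

{-# OPTIONS --safe #-}
module Submission where

-- Put γ = U_{r+s}, α = U_s and β = -q^s U_r.  The addition formula
-- U_{r+s} W_t = U_s W_{t+r} + q^s U_r W_{t-s} (both sides satisfy the recurrence in r and
-- agree at r = 0, 1) says γ W_t + β W_{t-s} = α W_{t+r}.  Iterating this, the binomial theorem
-- gives Σ_k C(n,k) γ^k β^{n-k} W_{t-s(n-k)} = α^n W_{t+rn}, which is the theorem for m = n - 1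
-- (where the left side reduces to its k = 0 term).  For fixed n both sides obey Pascal's rule
-- X(m+1, n+1) = X(m, n+1) + γ X(m, n); since C(x,k) is defined for every integer x, induction on n
-- and on m, upwards and downwards from m = n - 1, gives the identity for all m ∈ ℤ.

open import Defs
open import Algebra.Bundles using (CommutativeRing)
open import Algebra.Solver.Ring.AlmostCommutativeRing using (_-Raw-AlmostCommutative⟶_; fromCommutativeRing)
import Algebra.Solver.Ring as RingSolver
open import Data.Nat as ℕ using (ℕ; zero; suc; _∸_; _!; z≤n)
import Data.Nat.Properties as ℕP
open import Data.Nat.Properties using (_!≢0)
import Data.Nat.DivMod as ℕ
open import Data.Integer as ℤ using (ℤ; +_; -[1+_]; _⊖_; 0ℤ; 1ℤ)
import Data.Integer.Properties as ℤP
open import Data.Integer.Divisibility.Signed using (_∣_; divides; ∣m∣n⇒∣m+n; ∣m+n∣n⇒∣m; *-monoʳ-∣)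
open import Data.Integer.Tactic.RingSolver using (solve-∀)
open import Data.Sign as Sign using (Sign)
open import Data.Maybe using (Maybe; just; nothing)
open import Data.Product using (Σ; _,_; proj₁)
open import Function using (_∘_)
open import Relation.Nullary using (¬_; yes; no)
open import Relation.Binary.PropositionalEquality as ≡ using (_≡_)

module IntegerCoefficients {c ℓ} (R : CommutativeRing c ℓ) where
  open CommutativeRing R
  open import Algebra.Properties.Ring ring using (-1*x≈-x)
  open import Algebra.Properties.AbelianGroup +-abelianGroup using (⁻¹-∙-comm)
  open import Algebra.Properties.Group +-group using (ε⁻¹≈ε; ⁻¹-involutive)
  open import Algebra.Properties.CommutativeSemigroup +-commutativeSemigroup
    using (interchange)
  open import Algebra.Properties.CommutativeSemigroup *-commutativeSemigroup
    using () renaming (interchange to *-interchange)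
  open import Algebra.Properties.Semiring.Mult semiring using (_×_; ×-homo-+; ×1-homo-*)
  open import Relation.Binary.Reasoning.Setoid setoid

  fromℕ≡×1# : ∀ n → fromℕ R n ≡ n × 1#
  fromℕ≡×1# zero    = ≡.refl
  fromℕ≡×1# (suc n) = ≡.cong (λ x → 1# + x) (fromℕ≡×1# n)

  fromℕ-+ : ∀ m n → fromℕ R (m ℕ.+ n) ≈ fromℕ R m + fromℕ R n
  fromℕ-+ m n rewrite fromℕ≡×1# (m ℕ.+ n) | fromℕ≡×1# m | fromℕ≡×1# n = ×-homo-+ 1# m n

  fromℕ-* : ∀ m n → fromℕ R (m ℕ.* n) ≈ fromℕ R m * fromℕ R n
  fromℕ-* m n rewrite fromℕ≡×1# (m ℕ.* n) | fromℕ≡×1# m | fromℕ≡×1# n = ×1-homo-* m n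

  fromℤ-⊖ : ∀ m n → fromℤ R (m ⊖ n) ≈ fromℕ R m - fromℕ R n
  fromℤ-⊖ zero    zero    = sym (trans (+-identityˡ _) ε⁻¹≈ε)
  fromℤ-⊖ zero    (suc n) = sym (+-identityˡ _)
  fromℤ-⊖ (suc m) zero    = sym (trans (+-congˡ ε⁻¹≈ε) (+-identityʳ _))
  fromℤ-⊖ (suc m) (suc n) = begin
    fromℤ R (suc m ⊖ suc n)                 ≡⟨ ≡.cong (fromℤ R) (ℤP.[1+m]⊖[1+n]≡m⊖n m n) ⟩
    fromℤ R (m ⊖ n)                         ≈⟨ fromℤ-⊖ m n ⟩
    fromℕ R m - fromℕ R n                   ≈⟨ +-identityˡ _ ⟨
    0# + (fromℕ R m - fromℕ R n)            ≈⟨ +-congʳ (-‿inverseʳ 1#) ⟨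
    (1# - 1#) + (fromℕ R m - fromℕ R n)     ≈⟨ interchange _ _ _ _ ⟩
    (1# + fromℕ R m) + (- 1# - fromℕ R n)   ≈⟨ +-congˡ (⁻¹-∙-comm 1# (fromℕ R n)) ⟩
    (1# + fromℕ R m) - (1# + fromℕ R n)     ∎

  fromℤ-+ : ∀ i j → fromℤ R (i ℤ.+ j) ≈ fromℤ R i + fromℤ R j
  fromℤ-+ -[1+ m ] -[1+ n ] = begin
    - fromℕ R (suc (suc (m ℕ.+ n)))          ≡⟨ ≡.cong (λ k → - fromℕ R k) (≡.sym (ℕP.+-suc (suc m) n)) ⟩
    - fromℕ R (suc m ℕ.+ suc n)              ≈⟨ -‿cong (fromℕ-+ (suc m) (suc n)) ⟩
    - (fromℕ R (suc m) + fromℕ R (suc n))    ≈⟨ ⁻¹-∙-comm _ _ ⟨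
    - fromℕ R (suc m) - fromℕ R (suc n)      ∎
  fromℤ-+ -[1+ m ] (+ n) = trans (fromℤ-⊖ n (suc m)) (+-comm _ _)
  fromℤ-+ (+ m)    -[1+ n ] = fromℤ-⊖ m (suc n)
  fromℤ-+ (+ m)    (+ n)    = fromℕ-+ m n

  fromℤ-neg : ∀ i → fromℤ R (ℤ.- i) ≈ - fromℤ R i
  fromℤ-neg -[1+ n ]  = sym (⁻¹-involutive _)
  fromℤ-neg (+ zero)  = sym ε⁻¹≈ε
  fromℤ-neg (+ suc n) = refl

  signValue : Sign → Carrier
  signValue Sign.+ = 1#
  signValue Sign.- = - 1#

  signValue-* : ∀ s t → signValue (s Sign.* t) ≈ signValue s * signValue t
  signValue-* Sign.- Sign.- = sym (trans (-1*x≈-x _) (⁻¹-involutive _))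
  signValue-* Sign.- Sign.+ = sym (*-identityʳ _)
  signValue-* Sign.+ _      = sym (*-identityˡ _)

  fromℤ-◃ : ∀ s n → fromℤ R (s ℤ.◃ n) ≈ signValue s * fromℕ R n
  fromℤ-◃ s      zero    = sym (zeroʳ _)
  fromℤ-◃ Sign.- (suc n) = sym (-1*x≈-x _)
  fromℤ-◃ Sign.+ (suc n) = sym (*-identityˡ _)

  fromℤ-signAbs : ∀ i → fromℤ R i ≈ signValue (ℤ.sign i) * fromℕ R ℤ.∣ i ∣
  fromℤ-signAbs i = trans (reflexive (≡.cong (fromℤ R) (≡.sym (ℤP.◃-inverse i))))
                          (fromℤ-◃ (ℤ.sign i) ℤ.∣ i ∣)

  fromℤ-* : ∀ i j → fromℤ R (i ℤ.* j) ≈ fromℤ R i * fromℤ R j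
  fromℤ-* i j = begin
    fromℤ R (i ℤ.* j)
      ≈⟨ fromℤ-◃ (ℤ.sign i Sign.* ℤ.sign j) (ℤ.∣ i ∣ ℕ.* ℤ.∣ j ∣) ⟩
    signValue (ℤ.sign i Sign.* ℤ.sign j) * fromℕ R (ℤ.∣ i ∣ ℕ.* ℤ.∣ j ∣)
      ≈⟨ *-cong (signValue-* (ℤ.sign i) (ℤ.sign j)) (fromℕ-* ℤ.∣ i ∣ ℤ.∣ j ∣) ⟩
    (signValue (ℤ.sign i) * signValue (ℤ.sign j)) * (fromℕ R ℤ.∣ i ∣ * fromℕ R ℤ.∣ j ∣)
      ≈⟨ *-interchange _ _ _ _ ⟩
    (signValue (ℤ.sign i) * fromℕ R ℤ.∣ i ∣) * (signValue (ℤ.sign j) * fromℕ R ℤ.∣ j ∣)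
      ≈⟨ *-cong (fromℤ-signAbs i) (fromℤ-signAbs j) ⟨
    fromℤ R i * fromℤ R j ∎

  -- Equal to fromℤ, but 0# and 1# on the nose at 0 and 1, so that the solver's constants
  -- are literally the ring's.
  coefficient : ℤ → Carrier
  coefficient (+ zero)     = 0#
  coefficient (+ suc zero) = 1#
  coefficient i            = fromℤ R i

  coefficient≈fromℤ : ∀ i → coefficient i ≈ fromℤ R i
  coefficient≈fromℤ (+ zero)          = refl
  coefficient≈fromℤ (+ suc zero)      = sym (+-identityʳ 1#)
  coefficient≈fromℤ (+ suc (suc n))   = refl
  coefficient≈fromℤ -[1+ n ]          = refl

  coefficient-homomorphism :
    CommutativeRing.rawRing ℤP.+-*-commutativeRing -Raw-AlmostCommutative⟶ fromCommutativeRing R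
  coefficient-homomorphism = record
    { ⟦_⟧    = coefficient
    ; +-homo = λ i j → transport (ℤ._+_ i j) (fromℤ-+ i j) (+-cong (coefficient≈fromℤ i) (coefficient≈fromℤ j))
    ; *-homo = λ i j → transport (ℤ._*_ i j) (fromℤ-* i j) (*-cong (coefficient≈fromℤ i) (coefficient≈fromℤ j))
    ; -‿homo = λ i → transport (ℤ.- i) (fromℤ-neg i) (-‿cong (coefficient≈fromℤ i))
    ; 0-homo = refl
    ; 1-homo = refl
    }
    where
    transport : ∀ k {x y} → fromℤ R k ≈ x → y ≈ x → coefficient k ≈ y
    transport k k≈x y≈x = trans (coefficient≈fromℤ k) (trans k≈x (sym y≈x))

  coefficient-≟ : ∀ i j → Maybe (coefficient i ≈ coefficient j)
  coefficient-≟ i j with i ℤ.≟ j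
  ... | yes ≡.refl = just refl
  ... | no _       = nothing

  open RingSolver (CommutativeRing.rawRing ℤP.+-*-commutativeRing) (fromCommutativeRing R)
    coefficient-homomorphism coefficient-≟ public

ℤ-induction : ∀ {a} (P : ℤ → Set a) →
              (∀ i → P i → P (ℤ.suc i)) → (∀ i → P (ℤ.suc i) → P i) →
              ∀ {i} → P i → ∀ j → P j
ℤ-induction P up down {i} Pi j = ≡.subst P (i+[j-i]≡j j i) (from-i (j ℤ.- i))
  where
  i+[j-i]≡j : ∀ j i → i ℤ.+ (j ℤ.- i) ≡ j
  i+[j-i]≡j = solve-∀
  suc-+ : ∀ i n → 1ℤ ℤ.+ (i ℤ.+ n) ≡ i ℤ.+ (1ℤ ℤ.+ n)
  suc-+ = solve-∀
  suc-- : ∀ i n → 1ℤ ℤ.+ (i ℤ.- (1ℤ ℤ.+ n)) ≡ i ℤ.- n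
  suc-- = solve-∀
  above : ∀ n → P (i ℤ.+ + n)
  above zero    = ≡.subst P (≡.sym (ℤP.+-identityʳ i)) Pi
  above (suc n) = ≡.subst P (suc-+ i (+ n)) (up _ (above n))
  below : ∀ n → P (i ℤ.- + n)
  below zero    = ≡.subst P (≡.sym (ℤP.+-identityʳ i)) Pi
  below (suc n) = down _ (≡.subst P (≡.sym (suc-- i (+ n))) (below n))
  from-i : ∀ d → P (i ℤ.+ d)
  from-i (+ n)    = above n
  from-i -[1+ n ] = below (suc n)

falling-pascal : ∀ x k → falling (ℤ.suc x) (suc k) ≡ falling x (suc k) ℤ.+ + suc k ℤ.* falling x k
falling-pascal x zero    = identity x
  where
  identity : ∀ x → 1ℤ ℤ.* ((1ℤ ℤ.+ x) ℤ.- 0ℤ) ≡ 1ℤ ℤ.* (x ℤ.- 0ℤ) ℤ.+ 1ℤ ℤ.* 1ℤ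
  identity = solve-∀
falling-pascal x (suc k) = begin
  falling (ℤ.suc x) (suc k) ℤ.* (ℤ.suc x ℤ.- + suc k)
    ≡⟨ ≡.cong (ℤ._* (ℤ.suc x ℤ.- + suc k)) (falling-pascal x k) ⟩
  (falling x k ℤ.* (x ℤ.- + k) ℤ.+ + suc k ℤ.* falling x k) ℤ.* (ℤ.suc x ℤ.- + suc k)
    ≡⟨ identity (falling x k) x (+ k) ⟩
  falling x k ℤ.* (x ℤ.- + k) ℤ.* (x ℤ.- + suc k) ℤ.+ + suc (suc k) ℤ.* (falling x k ℤ.* (x ℤ.- + k)) ∎
  where
  open ≡.≡-Reasoning
  identity : ∀ f x k →
             (f ℤ.* (x ℤ.- k) ℤ.+ (1ℤ ℤ.+ k) ℤ.* f) ℤ.* ((1ℤ ℤ.+ x) ℤ.- (1ℤ ℤ.+ k))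
             ≡ f ℤ.* (x ℤ.- k) ℤ.* (x ℤ.- (1ℤ ℤ.+ k)) ℤ.+ (1ℤ ℤ.+ (1ℤ ℤ.+ k)) ℤ.* (f ℤ.* (x ℤ.- k))
  identity = solve-∀

falling-vanishes : ∀ k → falling (+ k) (suc k) ≡ 0ℤ
falling-vanishes k =
  ≡.trans (≡.cong (falling (+ k) k ℤ.*_) (ℤP.+-inverseʳ (+ k))) (ℤP.*-zeroʳ (falling (+ k) k))

!∣falling : ∀ k x → + (k !) ∣ falling x k
!∣falling zero    x = divides (falling x 0) ≡.refl
!∣falling (suc k) = ℤ-induction (λ x → + (suc k !) ∣ falling x (suc k)) up down base
  where
  [1+k]!∣[1+k]*falling : ∀ x → + (suc k !) ∣ + suc k ℤ.* falling x k
  [1+k]!∣[1+k]*falling x = ≡.subst (_∣ + suc k ℤ.* falling x k) (≡.sym (ℤP.pos-* (suc k) (k !)))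
                                   (*-monoʳ-∣ (+ suc k) (!∣falling k x))
  base : + (suc k !) ∣ falling (+ k) (suc k)
  base = divides 0ℤ (falling-vanishes k)
  up : ∀ x → + (suc k !) ∣ falling x (suc k) → + (suc k !) ∣ falling (ℤ.suc x) (suc k)
  up x ∣falling = ≡.subst (_ ∣_) (≡.sym (falling-pascal x k)) (∣m∣n⇒∣m+n ∣falling ([1+k]!∣[1+k]*falling x))
  down : ∀ x → + (suc k !) ∣ falling (ℤ.suc x) (suc k) → + (suc k !) ∣ falling x (suc k)
  down x ∣falling = ∣m+n∣n⇒∣m (≡.subst (_ ∣_) (falling-pascal x k) ∣falling) ([1+k]!∣[1+k]*falling x)

*ℕ-/ℕ : ∀ y d .{{_ : ℕ.NonZero d}} → (y ℤ.* + d) ℤ./ℕ d ≡ y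
*ℕ-/ℕ (+ a)    d       = ≡.trans (≡.cong (ℤ._/ℕ d) (≡.sym (ℤP.pos-* a d))) (≡.cong +_ (ℕ.m*n/n≡m a d))
*ℕ-/ℕ -[1+ a ] (suc d) rewrite ℕ.m*n%n≡0 (suc a) (suc d) {{_}} =
  ≡.cong (λ z → ℤ.- (+ z)) (ℕ.m*n/n≡m (suc a) (suc d))

falling≡binom*! : ∀ x k → falling x k ≡ binom x k ℤ.* + (k !)
falling≡binom*! x k with !∣falling k x
... | divides y falling≡y*k! = ≡.trans falling≡y*k! (≡.cong (ℤ._* + (k !)) (≡.sym binom≡y))
  where
  binom≡y : binom x k ≡ y
  binom≡y = ≡.trans (≡.cong (λ z → ℤ._/ℕ_ z (k !) {{k !≢0}}) falling≡y*k!) (*ℕ-/ℕ y (k !) {{k !≢0}})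

binom-pascal : ∀ x k → binom (ℤ.suc x) (suc k) ≡ binom x (suc k) ℤ.+ binom x k
binom-pascal x k = ℤP.*-cancelʳ-≡ _ _ (+ (suc k !)) {{suc k !≢0}} (begin
  binom (ℤ.suc x) (suc k) ℤ.* + (suc k !)            ≡⟨ falling≡binom*! (ℤ.suc x) (suc k) ⟨
  falling (ℤ.suc x) (suc k)                          ≡⟨ falling-pascal x k ⟩
  falling x (suc k) ℤ.+ + suc k ℤ.* falling x k
    ≡⟨ ≡.cong₂ (λ a b → a ℤ.+ + suc k ℤ.* b) (falling≡binom*! x (suc k)) (falling≡binom*! x k) ⟩
  b₁ ℤ.* + (suc k !) ℤ.+ + suc k ℤ.* (b₀ ℤ.* + (k !))  ≡⟨ ≡.cong (λ f → b₁ ℤ.* f ℤ.+ + suc k ℤ.* (b₀ ℤ.* + (k !))) [1+k]! ⟩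
  b₁ ℤ.* (+ suc k ℤ.* + (k !)) ℤ.+ + suc k ℤ.* (b₀ ℤ.* + (k !))  ≡⟨ identity b₁ b₀ (+ suc k) (+ (k !)) ⟩
  (b₁ ℤ.+ b₀) ℤ.* (+ suc k ℤ.* + (k !))              ≡⟨ ≡.cong ((b₁ ℤ.+ b₀) ℤ.*_) [1+k]! ⟨
  (b₁ ℤ.+ b₀) ℤ.* + (suc k !)                        ∎)
  where
  open ≡.≡-Reasoning
  b₁ = binom x (suc k)
  b₀ = binom x k
  [1+k]! : + (suc k !) ≡ + suc k ℤ.* + (k !)
  [1+k]! = ℤP.pos-* (suc k) (k !)
  identity : ∀ b₁ b₀ n f → b₁ ℤ.* (n ℤ.* f) ℤ.+ n ℤ.* (b₀ ℤ.* f) ≡ (b₁ ℤ.+ b₀) ℤ.* (n ℤ.* f)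
  identity = solve-∀

binom-vanishes : ∀ k → binom (+ k) (suc k) ≡ 0ℤ
binom-vanishes k = ≡.trans (≡.cong (λ z → ℤ._/ℕ_ z (suc k !) {{suc k !≢0}}) (falling-vanishes k))
                           (≡.cong +_ (ℕ.0/n≡0 (suc k !) {{suc k !≢0}}))

module BinomialSums {c ℓ} (R : CommutativeRing c ℓ) where
  open CommutativeRing R
  open IntegerCoefficients R
  open import Algebra.Properties.CommutativeSemiring.Exp commutativeSemiring using (_^_; ^-distrib-*)
  open import Relation.Binary.Reasoning.Setoid setoid

  sum-cong : ∀ n {f g : ℕ → Carrier} → (∀ k → k ℕ.≤ n → f k ≈ g k) → sumTo R n f ≈ sumTo R n g
  sum-cong zero    f≈g = f≈g 0 z≤n
  sum-cong (suc n) f≈g = +-cong (sum-cong n (λ k k≤n → f≈g k (ℕP.m≤n⇒m≤1+n k≤n))) (f≈g (suc n) ℕP.≤-refl)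

  sum-+ : ∀ n (f g : ℕ → Carrier) → sumTo R n (λ k → f k + g k) ≈ sumTo R n f + sumTo R n g
  sum-+ zero    f g = refl
  sum-+ (suc n) f g = trans (+-congʳ (sum-+ n f g))
    (solve 4 (λ x y z w → (x :+ y) :+ (z :+ w) := (x :+ z) :+ (y :+ w)) refl _ _ _ _)

  sum-*ˡ : ∀ n x (f : ℕ → Carrier) → sumTo R n (λ k → x * f k) ≈ x * sumTo R n f
  sum-*ˡ zero    x f = refl
  sum-*ˡ (suc n) x f = trans (+-congʳ (sum-*ˡ n x f)) (sym (distribˡ _ _ _))

  sum-head : ∀ n (f : ℕ → Carrier) → sumTo R (suc n) f ≈ f 0 + sumTo R n (f ∘ suc)
  sum-head zero    f = refl
  sum-head (suc n) f = trans (+-congʳ (sum-head n f)) (+-assoc _ _ _)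

  sum-zero : ∀ n (f : ℕ → Carrier) → (∀ k → f k ≈ 0#) → sumTo R n f ≈ 0#
  sum-zero zero    f f≈0 = f≈0 0
  sum-zero (suc n) f f≈0 = trans (+-cong (sum-zero n f f≈0) (f≈0 (suc n))) (+-identityʳ 0#)

  pow≡^ : ∀ x n → pow R x n ≡ x ^ n
  pow≡^ x zero    = ≡.refl
  pow≡^ x (suc n) = ≡.cong (x *_) (pow≡^ x n)

  pow-distrib-* : ∀ x y n → pow R (x * y) n ≈ pow R x n * pow R y n
  pow-distrib-* x y n rewrite pow≡^ (x * y) n | pow≡^ x n | pow≡^ y n = ^-distrib-* x y n

  binomialSum : (ℕ → ℤ) → Carrier → Carrier → (ℕ → Carrier) → ℕ → Carrier
  binomialSum u x y w n =
    sumTo R n (λ k → fromℤ R (binom (u k) k) * pow R x k * pow R y (n ∸ k) * w (n ∸ k))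

  binomialSum-cong : ∀ {u v} x y {w w′} n → (∀ k → u k ≡ v k) → (∀ j → w j ≈ w′ j) →
                     binomialSum u x y w n ≈ binomialSum v x y w′ n
  binomialSum-cong x y n u≡v w≈w′ = sum-cong n λ k _ →
    *-cong (*-congʳ (*-congʳ (reflexive (≡.cong (λ i → fromℤ R (binom i k)) (u≡v k))))) (w≈w′ (n ∸ k))

  private
    unit-weight : ∀ i (a b : Carrier) → fromℤ R (binom i 0) * 1# * a * b ≈ a * b
    unit-weight _ a b = *-congʳ (trans (*-congʳ (trans (*-identityʳ _) (+-identityʳ 1#))) (*-identityˡ a))

    zero-weight : ∀ i k (a b c : Carrier) → binom i k ≡ 0ℤ → fromℤ R (binom i k) * a * b * c ≈ 0#
    zero-weight _ _ a b c binom≡0 rewrite binom≡0 =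
      solve 3 (λ a b c → con 0ℤ :* a :* b :* c := con 0ℤ) refl a b c

  binomialSum-zero : ∀ u x y w → binomialSum u x y w 0 ≈ w 0
  binomialSum-zero u x y w = trans (unit-weight (u 0) 1# (w 0)) (*-identityˡ (w 0))

  binomialSum-head : ∀ u x y w n → (∀ k → binom (u (suc k)) (suc k) ≡ 0ℤ) →
                     binomialSum u x y w n ≈ pow R y n * w n
  binomialSum-head u x y w zero    _      = trans (binomialSum-zero u x y w) (sym (*-identityˡ (w 0)))
  binomialSum-head u x y w (suc n) vanish = begin
    binomialSum u x y w (suc n)      ≈⟨ sum-head n _ ⟩
    _ + sumTo R n _
      ≈⟨ +-cong (unit-weight (u 0) _ _) (sum-zero n _ λ k → zero-weight (u (suc k)) (suc k) _ _ _ (vanish k)) ⟩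
    pow R y (suc n) * w (suc n) + 0# ≈⟨ +-identityʳ _ ⟩
    pow R y (suc n) * w (suc n)      ∎

  binomialSum-pascal : ∀ {u v} x y w n → (∀ k → u k ≡ ℤ.suc (v k)) →
                       binomialSum u x y w (suc n) ≈ binomialSum v x y w (suc n) + x * binomialSum (v ∘ suc) x y w n
  binomialSum-pascal {u} {v} x y w n u≡1+v = begin
    binomialSum u x y w (suc n)                                    ≈⟨ sum-head n _ ⟩
    term v 0 + sumTo R n (term u ∘ suc)                            ≈⟨ +-congˡ (sum-cong n λ k _ → split k) ⟩
    term v 0 + sumTo R n (λ k → term v (suc k) + x * term′ k)      ≈⟨ +-congˡ (sum-+ n _ _) ⟩
    term v 0 + (sumTo R n (term v ∘ suc) + sumTo R n (λ k → x * term′ k))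
                                                                   ≈⟨ +-congˡ (+-congˡ (sum-*ˡ n x term′)) ⟩
    term v 0 + (sumTo R n (term v ∘ suc) + x * binomialSum (v ∘ suc) x y w n)
                                                                   ≈⟨ +-assoc _ _ _ ⟨
    (term v 0 + sumTo R n (term v ∘ suc)) + x * binomialSum (v ∘ suc) x y w n
                                                                   ≈⟨ +-congʳ (sum-head n _) ⟨
    binomialSum v x y w (suc n) + x * binomialSum (v ∘ suc) x y w n ∎
    where
    term : (ℕ → ℤ) → ℕ → Carrier
    term u′ k = fromℤ R (binom (u′ k) k) * pow R x k * pow R y (suc n ∸ k) * w (suc n ∸ k)
    term′ : ℕ → Carrier
    term′ k = fromℤ R (binom (v (suc k)) k) * pow R x k * pow R y (n ∸ k) * w (n ∸ k)
    split : ∀ k → term u (suc k) ≈ term v (suc k) + x * term′ k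
    split k = begin
      fromℤ R (binom (u (suc k)) (suc k)) * (x * xᵏ) * yⁿ⁻ᵏ * wₙ₋ₖ
        ≈⟨ *-congʳ (*-congʳ (*-congʳ (reflexive (≡.cong (fromℤ R) pascal)))) ⟩
      fromℤ R (binom (v (suc k)) (suc k) ℤ.+ binom (v (suc k)) k) * (x * xᵏ) * yⁿ⁻ᵏ * wₙ₋ₖ
        ≈⟨ *-congʳ (*-congʳ (*-congʳ (fromℤ-+ (binom (v (suc k)) (suc k)) (binom (v (suc k)) k)))) ⟩
      (fromℤ R (binom (v (suc k)) (suc k)) + fromℤ R (binom (v (suc k)) k)) * (x * xᵏ) * yⁿ⁻ᵏ * wₙ₋ₖ
        ≈⟨ solve 6 (λ b b′ x xᵏ y w → (b :+ b′) :* (x :* xᵏ) :* y :* w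
                                     := b :* (x :* xᵏ) :* y :* w :+ x :* (b′ :* xᵏ :* y :* w))
                   refl _ _ x xᵏ yⁿ⁻ᵏ wₙ₋ₖ ⟩
      term v (suc k) + x * term′ k ∎
      where
      pascal : binom (u (suc k)) (suc k) ≡ binom (v (suc k)) (suc k) ℤ.+ binom (v (suc k)) k
      pascal = ≡.trans (≡.cong (λ i → binom i (suc k)) (u≡1+v (suc k))) (binom-pascal (v (suc k)) k)
      xᵏ = pow R x k
      yⁿ⁻ᵏ = pow R y (n ∸ k)
      wₙ₋ₖ = w (n ∸ k)

  binomialSum-last : ∀ u x y w n → binom (u (suc n)) (suc n) ≡ 0ℤ →
                     binomialSum u x y w (suc n) ≈ y * binomialSum u x y (w ∘ suc) n
  binomialSum-last u x y w n vanish = begin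
    binomialSum u x y w (suc n)                ≈⟨ +-cong (sum-cong n shift) (zero-weight (u (suc n)) (suc n) _ _ _ vanish) ⟩
    sumTo R n (λ k → y * term k) + 0#          ≈⟨ +-identityʳ _ ⟩
    sumTo R n (λ k → y * term k)               ≈⟨ sum-*ˡ n y term ⟩
    y * binomialSum u x y (w ∘ suc) n          ∎
    where
    term : ℕ → Carrier
    term k = fromℤ R (binom (u k) k) * pow R x k * pow R y (n ∸ k) * w (suc (n ∸ k))
    shift : ∀ k → k ℕ.≤ n →
            fromℤ R (binom (u k) k) * pow R x k * pow R y (suc n ∸ k) * w (suc n ∸ k) ≈ y * term k
    shift k k≤n rewrite ℕP.+-∸-assoc 1 k≤n =
      solve 4 (λ b y yⁿ⁻ᵏ w → b :* (y :* yⁿ⁻ᵏ) :* w := y :* (b :* yⁿ⁻ᵏ :* w)) refl _ y _ _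

  module ShiftIdentity (γ α β : Carrier) (V : ℤ → Carrier) (r s : ℤ)
    (shift : ∀ t → γ * V t + β * V (t ℤ.- s) ≈ α * V (t ℤ.+ r)) where
    open import Algebra.Properties.Ring ring using (+-cancelʳ)

    ascending descending : ℤ → ℕ → Carrier
    ascending  t j = V (t ℤ.+ r ℤ.* + j)
    descending t j = V (t ℤ.- s ℤ.* + j)

    left : ℤ → ℕ → ℤ → Carrier
    left m n t = binomialSum (λ k → m ℤ.- + n ℤ.+ + k) γ α (ascending t) n

    -- Upper index 1 + m rather than m + 1: it reduces to + suc m′ at m = + m′.
    right : ℤ → ℕ → ℤ → Carrier
    right m n t = binomialSum (λ _ → 1ℤ ℤ.+ m) γ β (descending t) n

    V-≡ : ∀ {i j} → i ≡ j → V i ≈ V j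
    V-≡ i≡j = reflexive (≡.cong V i≡j)

    expansion : ∀ n t → binomialSum (λ _ → + n) γ β (descending t) n ≈ pow R α n * ascending t n
    expansion zero    t = trans (binomialSum-zero (λ _ → + 0) γ β (descending t))
      (trans (V-≡ (index t s r)) (sym (*-identityˡ _)))
      where
      index : ∀ t s r → t ℤ.- s ℤ.* 0ℤ ≡ t ℤ.+ r ℤ.* 0ℤ
      index = solve-∀
    expansion (suc n) t = begin
      binomialSum (λ _ → + suc n) γ β (descending t) (suc n)
        ≈⟨ binomialSum-pascal γ β (descending t) n (λ _ → ≡.refl) ⟩
      binomialSum (λ _ → + n) γ β (descending t) (suc n) + γ * binomialSum (λ _ → + n) γ β (descending t) n
        ≈⟨ +-congʳ (binomialSum-last _ γ β (descending t) n (binom-vanishes n)) ⟩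
      β * binomialSum (λ _ → + n) γ β (descending t ∘ suc) n + γ * binomialSum (λ _ → + n) γ β (descending t) n
        ≈⟨ +-congʳ (*-congˡ (binomialSum-cong γ β n (λ _ → ≡.refl) λ j → V-≡ (index₁ t s (+ j)))) ⟩
      β * binomialSum (λ _ → + n) γ β (descending (t ℤ.- s)) n + γ * binomialSum (λ _ → + n) γ β (descending t) n
        ≈⟨ +-cong (*-congˡ (expansion n (t ℤ.- s))) (*-congˡ (expansion n t)) ⟩
      β * (αⁿ * V (t ℤ.- s ℤ.+ r ℤ.* + n)) + γ * (αⁿ * V t′)
        ≈⟨ +-congʳ (*-congˡ (*-congˡ (V-≡ (index₂ t s r (+ n))))) ⟩
      β * (αⁿ * V (t′ ℤ.- s)) + γ * (αⁿ * V t′)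
        ≈⟨ solve 5 (λ β αⁿ v v′ γ → β :* (αⁿ :* v′) :+ γ :* (αⁿ :* v) := αⁿ :* (γ :* v :+ β :* v′))
                   refl β αⁿ (V t′) (V (t′ ℤ.- s)) γ ⟩
      αⁿ * (γ * V t′ + β * V (t′ ℤ.- s))
        ≈⟨ *-congˡ (shift t′) ⟩
      αⁿ * (α * V (t′ ℤ.+ r))
        ≈⟨ solve 3 (λ αⁿ α v → αⁿ :* (α :* v) := α :* αⁿ :* v) refl αⁿ α _ ⟩
      α * αⁿ * V (t′ ℤ.+ r)
        ≈⟨ *-congˡ (V-≡ (index₃ t r (+ n))) ⟩
      pow R α (suc n) * ascending t (suc n) ∎
      where
      αⁿ = pow R α n
      t′ = t ℤ.+ r ℤ.* + n
      index₁ : ∀ t s j → t ℤ.- s ℤ.* (1ℤ ℤ.+ j) ≡ t ℤ.- s ℤ.- s ℤ.* j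
      index₁ = solve-∀
      index₂ : ∀ t s r n → t ℤ.- s ℤ.+ r ℤ.* n ≡ t ℤ.+ r ℤ.* n ℤ.- s
      index₂ = solve-∀
      index₃ : ∀ t r n → t ℤ.+ r ℤ.* n ℤ.+ r ≡ t ℤ.+ r ℤ.* (1ℤ ℤ.+ n)
      index₃ = solve-∀

    left-diagonal : ∀ n t → left (+ n) (suc n) t ≈ pow R α (suc n) * ascending t (suc n)
    left-diagonal n t = binomialSum-head _ γ α (ascending t) (suc n) λ k →
      ≡.trans (≡.cong (λ i → binom i (suc k)) (index (+ n) (+ k))) (binom-vanishes k)
      where
      index : ∀ n k → n ℤ.- (1ℤ ℤ.+ n) ℤ.+ (1ℤ ℤ.+ k) ≡ k
      index = solve-∀

    left-pascal : ∀ m n t → left (ℤ.suc m) (suc n) t ≈ left m (suc n) t + γ * left m n t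
    left-pascal m n t = trans (binomialSum-pascal γ α (ascending t) n (λ k → index₁ m (+ n) (+ k)))
      (+-congˡ (*-congˡ (binomialSum-cong γ α {w = ascending t} n (λ k → index₂ m (+ n) (+ k)) λ _ → refl)))
      where
      index₁ : ∀ m n k → 1ℤ ℤ.+ m ℤ.- (1ℤ ℤ.+ n) ℤ.+ k ≡ 1ℤ ℤ.+ (m ℤ.- (1ℤ ℤ.+ n) ℤ.+ k)
      index₁ = solve-∀
      index₂ : ∀ m n k → m ℤ.- (1ℤ ℤ.+ n) ℤ.+ (1ℤ ℤ.+ k) ≡ m ℤ.- n ℤ.+ k
      index₂ = solve-∀

    right-pascal : ∀ m n t → right (ℤ.suc m) (suc n) t ≈ right m (suc n) t + γ * right m n t
    right-pascal m n t = binomialSum-pascal γ β (descending t) n λ _ → ≡.refl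

    left≈right : ∀ n m t → left m n t ≈ right m n t
    left≈right zero    m t = trans (binomialSum-zero (λ k → m ℤ.- + 0 ℤ.+ + k) γ α (ascending t))
      (trans (V-≡ (index t r s)) (sym (binomialSum-zero (λ _ → 1ℤ ℤ.+ m) γ β (descending t))))
      where
      index : ∀ t r s → t ℤ.+ r ℤ.* 0ℤ ≡ t ℤ.- s ℤ.* 0ℤ
      index = solve-∀
    left≈right (suc n) m t = ℤ-induction P up down {+ n} diagonal m t
      where
      P : ℤ → Set _
      P m = ∀ t → left m (suc n) t ≈ right m (suc n) t
      diagonal : P (+ n)
      diagonal t = trans (left-diagonal n t) (sym (expansion (suc n) t))
      up : ∀ m → P m → P (ℤ.suc m)
      up m ih t = begin
        left (ℤ.suc m) (suc n) t            ≈⟨ left-pascal m n t ⟩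
        left m (suc n) t + γ * left m n t   ≈⟨ +-cong (ih t) (*-congˡ (left≈right n m t)) ⟩
        right m (suc n) t + γ * right m n t ≈⟨ right-pascal m n t ⟨
        right (ℤ.suc m) (suc n) t           ∎
      down : ∀ m → P (ℤ.suc m) → P m
      down m ih t = +-cancelʳ (γ * left m n t) _ _ (begin
        left m (suc n) t + γ * left m n t    ≈⟨ left-pascal m n t ⟨
        left (ℤ.suc m) (suc n) t             ≈⟨ ih t ⟩
        right (ℤ.suc m) (suc n) t            ≈⟨ right-pascal m n t ⟩
        right m (suc n) t + γ * right m n t  ≈⟨ +-congˡ (*-congˡ (left≈right n m t)) ⟨
        right m (suc n) t + γ * left m n t   ∎)

module Horadam {c ℓ} (R : CommutativeRing c ℓ) where
  open CommutativeRing R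
  open import Data.Product using (_×_)
  open IntegerCoefficients R
  open import Relation.Binary.Reasoning.Setoid setoid

  module Recurrence (p q qi : Carrier) (q*qi≈1 : q * qi ≈ 1#) where

    Recurrent : (ℤ → Carrier) → Set ℓ
    Recurrent f = ∀ j → f (ℤ.suc (ℤ.suc j)) ≈ p * f (ℤ.suc j) - q * f j

    q*[qi*x]≈x : ∀ x → q * (qi * x) ≈ x
    q*[qi*x]≈x x = trans (sym (*-assoc q qi x)) (trans (*-congʳ q*qi≈1) (*-identityˡ x))

    qi*[q*x]≈x : ∀ x → qi * (q * x) ≈ x
    qi*[q*x]≈x x = trans (sym (*-assoc qi q x)) (trans (*-congʳ (trans (*-comm qi q) q*qi≈1)) (*-identityˡ x))

    recurrent-q* : ∀ {f} → Recurrent f → ∀ j → q * f j ≈ p * f (ℤ.suc j) - f (ℤ.suc (ℤ.suc j))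
    recurrent-q* {f} rec j = begin
      q * f j                                              ≈⟨ solve 2 (λ y z → y := z :- (z :- y)) refl _ (p * f (ℤ.suc j)) ⟩
      p * f (ℤ.suc j) - (p * f (ℤ.suc j) - q * f j)        ≈⟨ +-congˡ (-‿cong (rec j)) ⟨
      p * f (ℤ.suc j) - f (ℤ.suc (ℤ.suc j))                ∎

    recurrent-backward : ∀ {f} → Recurrent f → ∀ j → f j ≈ qi * (p * f (ℤ.suc j) - f (ℤ.suc (ℤ.suc j)))
    recurrent-backward {f} rec j = trans (sym (qi*[q*x]≈x (f j))) (*-congˡ (recurrent-q* rec j))

    backward-step : ∀ x y → y ≈ p * x - q * (qi * (p * x - y))
    backward-step x y = begin
      y                                 ≈⟨ solve 2 (λ y z → y := z :- (z :- y)) refl y (p * x) ⟩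
      p * x - (p * x - y)               ≈⟨ +-congˡ (-‿cong (q*[qi*x]≈x _)) ⟨
      p * x - q * (qi * (p * x - y))    ∎

    W-recurrent : ∀ a b → Recurrent (W R a b p q qi)
    W-recurrent a b (+ n)              = refl
    W-recurrent a b -[1+ zero ]        = backward-step a b
    W-recurrent a b -[1+ suc zero ]    = backward-step (Wneg R a b p q qi 1) a
    W-recurrent a b -[1+ suc (suc n) ] =
      backward-step (Wneg R a b p q qi (suc (suc n))) (Wneg R a b p q qi (suc n))

    recurrent-unique : ∀ {f g} → Recurrent f → Recurrent g →
                       f 0ℤ ≈ g 0ℤ → f 1ℤ ≈ g 1ℤ → ∀ j → f j ≈ g j
    recurrent-unique {f} {g} rec-f rec-g f₀≈g₀ f₁≈g₁ j =
      proj₁ (ℤ-induction P up down (f₀≈g₀ , f₁≈g₁) j)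
      where
      P : ℤ → Set ℓ
      P j = f j ≈ g j × f (ℤ.suc j) ≈ g (ℤ.suc j)
      up : ∀ j → P j → P (ℤ.suc j)
      up j (fj≈gj , fj′≈gj′) = fj′≈gj′ , (begin
        f (ℤ.suc (ℤ.suc j))             ≈⟨ rec-f j ⟩
        p * f (ℤ.suc j) - q * f j       ≈⟨ +-cong (*-congˡ fj′≈gj′) (-‿cong (*-congˡ fj≈gj)) ⟩
        p * g (ℤ.suc j) - q * g j       ≈⟨ rec-g j ⟨
        g (ℤ.suc (ℤ.suc j))             ∎)
      down : ∀ j → P (ℤ.suc j) → P j
      down j (fj′≈gj′ , fj″≈gj″) = (begin
        f j                                             ≈⟨ recurrent-backward rec-f j ⟩
        qi * (p * f (ℤ.suc j) - f (ℤ.suc (ℤ.suc j)))    ≈⟨ *-congˡ (+-cong (*-congˡ fj′≈gj′) (-‿cong fj″≈gj″)) ⟩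
        qi * (p * g (ℤ.suc j) - g (ℤ.suc (ℤ.suc j)))    ≈⟨ recurrent-backward rec-g j ⟨
        g j                                             ∎) , fj′≈gj′

    recurrent-+ : ∀ {f g} → Recurrent f → Recurrent g → Recurrent (λ j → f j + g j)
    recurrent-+ {f} {g} rec-f rec-g j = trans (+-cong (rec-f j) (rec-g j))
      (solve 6 (λ p q f′ f g′ g → (p :* f′ :- q :* f) :+ (p :* g′ :- q :* g) := p :* (f′ :+ g′) :- q :* (f :+ g))
        refl p q (f (ℤ.suc j)) (f j) (g (ℤ.suc j)) (g j))

    recurrent-*ˡ : ∀ x {f} → Recurrent f → Recurrent (λ j → x * f j)
    recurrent-*ˡ x {f} rec-f j = trans (*-congˡ (rec-f j))
      (solve 5 (λ x p q f′ f → x :* (p :* f′ :- q :* f) := p :* (x :* f′) :- q :* (x :* f))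
        refl x p q (f (ℤ.suc j)) (f j))

    recurrent-shift : ∀ d {f} → Recurrent f → Recurrent (λ j → f (d ℤ.+ j))
    recurrent-shift d {f} rec-f j = begin
      f (d ℤ.+ ℤ.suc (ℤ.suc j))                     ≈⟨ f-≡ (suc-+ d (ℤ.suc j)) ⟨
      f (ℤ.suc (d ℤ.+ ℤ.suc j))                     ≈⟨ f-≡ (≡.cong ℤ.suc (suc-+ d j)) ⟨
      f (ℤ.suc (ℤ.suc (d ℤ.+ j)))                   ≈⟨ rec-f (d ℤ.+ j) ⟩
      p * f (ℤ.suc (d ℤ.+ j)) - q * f (d ℤ.+ j)     ≈⟨ +-congʳ (*-congˡ (f-≡ (suc-+ d j))) ⟩
      p * f (d ℤ.+ ℤ.suc j) - q * f (d ℤ.+ j)       ∎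
      where
      f-≡ : ∀ {i j} → i ≡ j → f i ≈ f j
      f-≡ i≡j = reflexive (≡.cong f i≡j)
      suc-+ : ∀ d j → 1ℤ ℤ.+ (d ℤ.+ j) ≡ d ℤ.+ (1ℤ ℤ.+ j)
      suc-+ = solve-∀

    qPow : ℤ → Carrier
    qPow = zpow R q qi

    qPow-suc : ∀ s → qPow (ℤ.suc s) ≈ q * qPow s
    qPow-suc (+ n)              = refl
    qPow-suc -[1+ zero ]        = sym (trans (*-congˡ (*-identityʳ qi)) q*qi≈1)
    qPow-suc -[1+ suc n ]       = sym (q*[qi*x]≈x _)

    u : ℤ → Carrier
    u = U R p q qi

    module _ (a b : Carrier) where
      w : ℤ → Carrier
      w = W R a b p q qi

      w-≡ : ∀ {i j} → i ≡ j → w i ≈ w j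
      w-≡ i≡j = reflexive (≡.cong w i≡j)

      reflected-recurrent : ∀ t → Recurrent (λ s → qPow s * w (t ℤ.- s))
      reflected-recurrent t s = begin
        qPow (ℤ.suc (ℤ.suc s)) * w j                    ≈⟨ *-congʳ (qPow-suc (ℤ.suc s)) ⟩
        q * qPow (ℤ.suc s) * w j                        ≈⟨ solve 3 (λ q x y → q :* x :* y := x :* (q :* y)) refl q _ _ ⟩
        qPow (ℤ.suc s) * (q * w j)                      ≈⟨ *-congˡ (recurrent-q* (W-recurrent a b) j) ⟩
        qPow (ℤ.suc s) * (p * w (ℤ.suc j) - w (ℤ.suc (ℤ.suc j)))
          ≈⟨ *-congˡ (+-cong (*-congˡ (w-≡ (index₁ t s))) (-‿cong (w-≡ (index₂ t s)))) ⟩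
        qPow (ℤ.suc s) * (p * w (t ℤ.- ℤ.suc s) - w (t ℤ.- s))
          ≈⟨ solve 4 (λ x p y z → x :* (p :* y :- z) := p :* (x :* y) :- x :* z) refl _ p _ _ ⟩
        p * (qPow (ℤ.suc s) * w (t ℤ.- ℤ.suc s)) - qPow (ℤ.suc s) * w (t ℤ.- s)
          ≈⟨ +-congˡ (-‿cong (trans (*-congʳ (qPow-suc s)) (*-assoc q _ _))) ⟩
        p * (qPow (ℤ.suc s) * w (t ℤ.- ℤ.suc s)) - q * (qPow s * w (t ℤ.- s)) ∎
        where
        j = t ℤ.- ℤ.suc (ℤ.suc s)
        index₁ : ∀ t s → 1ℤ ℤ.+ (t ℤ.- (1ℤ ℤ.+ (1ℤ ℤ.+ s))) ≡ t ℤ.- (1ℤ ℤ.+ s)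
        index₁ = solve-∀
        index₂ : ∀ t s → 1ℤ ℤ.+ (1ℤ ℤ.+ (t ℤ.- (1ℤ ℤ.+ (1ℤ ℤ.+ s)))) ≡ t ℤ.- s
        index₂ = solve-∀

      addition-formula₁ : ∀ t s → w t * u (ℤ.suc s) ≈ w (ℤ.suc t) * u s + qPow s * w (t ℤ.- s)
      addition-formula₁ t = recurrent-unique
        (recurrent-*ˡ (w t) (recurrent-shift 1ℤ (W-recurrent 0# 1#)))
        (recurrent-+ (recurrent-*ˡ (w (ℤ.suc t)) (W-recurrent 0# 1#)) (reflected-recurrent t))
        at-0 at-1
        where
        at-0 : w t * 1# ≈ w (ℤ.suc t) * 0# + 1# * w (t ℤ.- 0ℤ)
        at-0 = trans (solve 2 (λ x y → x :* con 1ℤ := y :* con 0ℤ :+ con 1ℤ :* x) refl (w t) (w (ℤ.suc t)))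
                     (+-congˡ (*-congˡ (w-≡ (≡.sym (ℤP.+-identityʳ t)))))
        w[1+t] : w (ℤ.suc t) ≈ p * w t - q * w (t ℤ.- 1ℤ)
        w[1+t] = begin
          w (ℤ.suc t)                                            ≈⟨ w-≡ (index₂ t) ⟨
          w (ℤ.suc (ℤ.suc (t ℤ.- 1ℤ)))                           ≈⟨ W-recurrent a b (t ℤ.- 1ℤ) ⟩
          p * w (ℤ.suc (t ℤ.- 1ℤ)) - q * w (t ℤ.- 1ℤ)            ≈⟨ +-congʳ (*-congˡ (w-≡ (index₁ t))) ⟩
          p * w t - q * w (t ℤ.- 1ℤ)                             ∎
          where
          index₁ : ∀ t → 1ℤ ℤ.+ (t ℤ.- 1ℤ) ≡ t
          index₁ = solve-∀
          index₂ : ∀ t → 1ℤ ℤ.+ (1ℤ ℤ.+ (t ℤ.- 1ℤ)) ≡ 1ℤ ℤ.+ t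
          index₂ = solve-∀
        at-1 : w t * (p * 1# - q * 0#) ≈ w (ℤ.suc t) * 1# + q * 1# * w (t ℤ.- 1ℤ)
        at-1 = begin
          w t * (p * 1# - q * 0#)
            ≈⟨ solve 4 (λ x p q y → x :* (p :* con 1ℤ :- q :* con 0ℤ)
                                    := (p :* x :- q :* y) :* con 1ℤ :+ q :* con 1ℤ :* y)
                 refl (w t) p q (w (t ℤ.- 1ℤ)) ⟩
          (p * w t - q * w (t ℤ.- 1ℤ)) * 1# + q * 1# * w (t ℤ.- 1ℤ)  ≈⟨ +-congʳ (*-congʳ w[1+t]) ⟨
          w (ℤ.suc t) * 1# + q * 1# * w (t ℤ.- 1ℤ)                   ∎

      addition-formula : ∀ r s t → u (r ℤ.+ s) * w t ≈ u s * w (t ℤ.+ r) + qPow s * u r * w (t ℤ.- s)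
      addition-formula r s t = begin
        u (r ℤ.+ s) * w t                       ≈⟨ trans (*-comm _ _) (*-congˡ (u-≡ (ℤP.+-comm r s))) ⟩
        w t * u (s ℤ.+ r)                       ≈⟨ recurrent-unique
                                                     (recurrent-*ˡ (w t) (recurrent-shift s (W-recurrent 0# 1#)))
                                                     (recurrent-+ (recurrent-*ˡ (u s) (recurrent-shift t (W-recurrent a b)))
                                                                  (recurrent-*ˡ z (W-recurrent 0# 1#)))
                                                     at-0 at-1 r ⟩
        u s * w (t ℤ.+ r) + z * u r             ≈⟨ +-congˡ (solve 3 (λ x y z → x :* y :* z := x :* z :* y) refl (qPow s) _ _) ⟩
        u s * w (t ℤ.+ r) + qPow s * u r * w (t ℤ.- s) ∎
        where
        z = qPow s * w (t ℤ.- s)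
        u-≡ : ∀ {i j} → i ≡ j → u i ≈ u j
        u-≡ i≡j = reflexive (≡.cong u i≡j)
        at-0 : w t * u (s ℤ.+ 0ℤ) ≈ u s * w (t ℤ.+ 0ℤ) + z * 0#
        at-0 = begin
          w t * u (s ℤ.+ 0ℤ)
            ≈⟨ trans (*-comm _ _) (*-cong (u-≡ (ℤP.+-identityʳ s)) (w-≡ (≡.sym (ℤP.+-identityʳ t)))) ⟩
          u s * w (t ℤ.+ 0ℤ)             ≈⟨ solve 2 (λ x z → x := x :+ z :* con 0ℤ) refl _ z ⟩
          u s * w (t ℤ.+ 0ℤ) + z * 0#    ∎
        at-1 : w t * u (s ℤ.+ 1ℤ) ≈ u s * w (t ℤ.+ 1ℤ) + z * 1#
        at-1 = begin
          w t * u (s ℤ.+ 1ℤ)             ≈⟨ *-congˡ (u-≡ (ℤP.+-comm s 1ℤ)) ⟩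
          w t * u (ℤ.suc s)              ≈⟨ addition-formula₁ t s ⟩
          w (ℤ.suc t) * u s + z          ≈⟨ solve 3 (λ x y c → x :* y :+ c := y :* x :+ c :* con 1ℤ) refl _ (u s) z ⟩
          u s * w (ℤ.suc t) + z * 1#     ≈⟨ +-congʳ (*-congˡ (w-≡ (ℤP.+-comm 1ℤ t))) ⟩
          u s * w (t ℤ.+ 1ℤ) + z * 1#    ∎

theorem1 : ∀ {c ℓ} (R : CommutativeRing c ℓ) →
    let open CommutativeRing R in
    -- R is a field
    ¬ (1# ≈ 0#) →
    (∀ x → ¬ (x ≈ 0#) → Σ Carrier (λ y → x * y ≈ 1#)) →
    (a b p q qi : Carrier) → ¬ (p ≈ 0#) → ¬ (q ≈ 0#) → q * qi ≈ 1# →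
    (r s t : ℤ) (m n : ℕ) →
    sumTo R n (λ k →
        fromℤ R (binom ((+ m) ℤ.- (+ n) ℤ.+ (+ k)) k)
        * pow R (U R p q qi (r ℤ.+ s)) k
        * pow R (U R p q qi s) (n ∸ k)
        * W R a b p q qi (t ℤ.+ r ℤ.* (+ (n ∸ k))))
    ≈
    sumTo R n (λ k →
        pow R (- zpow R q qi s) (n ∸ k)
        * fromℤ R (binom (+ (ℕ.suc m)) k)
        * pow R (U R p q qi (r ℤ.+ s)) k
        * pow R (U R p q qi r) (n ∸ k)
        * W R a b p q qi (t ℤ.- s ℤ.* (+ (n ∸ k))))
theorem1 R _ _ a b p q qi _ _ q*qi≈1 r s t m n =
  trans (left≈right n (+ m) t) (sum-cong n λ k _ → reorder (n ∸ k) (fromℤ R (binom (+ suc m) k)) (pow R γ k) _)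
  where
  open CommutativeRing R
  open IntegerCoefficients R
  open BinomialSums R
  open Horadam R
  open Recurrence p q qi q*qi≈1
  γ = u (r ℤ.+ s)
  β = - qPow s * u r
  shift : ∀ t → γ * w a b t + β * w a b (t ℤ.- s) ≈ u s * w a b (t ℤ.+ r)
  shift t = begin
    γ * w a b t + β * w a b (t ℤ.- s)                               ≈⟨ +-congʳ (addition-formula a b r s t) ⟩
    u s * w a b (t ℤ.+ r) + qPow s * u r * w a b (t ℤ.- s) + β * w a b (t ℤ.- s)
      ≈⟨ solve 4 (λ x z y v → x :+ z :* y :* v :+ (:- z :* y) :* v := x) refl _ (qPow s) (u r) _ ⟩
    u s * w a b (t ℤ.+ r)                                           ∎
    where open import Relation.Binary.Reasoning.Setoid setoid
  open ShiftIdentity γ (u s) β (w a b) r s shift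
  reorder : ∀ j x y z → x * y * pow R β j * z ≈ pow R (- qPow s) j * x * y * pow R (u r) j * z
  reorder j x y z = trans (*-congʳ (*-congˡ (pow-distrib-* (- qPow s) (u r) j)))
    (solve 5 (λ x y a b z → x :* y :* (a :* b) :* z := a :* x :* y :* b :* z) refl x y _ _ z)
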